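{- Let $\mathcal{A}=(Q,E,s,F)$ be an NFA and let $R$ be a co-lex relation on $\mathcal{A}$ (with respect to the labels $\lambda$ in which $@$ marks the initial state). Then $R$ is co-lexicographically monotonic: $(u,v)\in R$ implies $I_u\preceq I_v$.
   Context: $\Sigma$ is a finite alphabet with a fixed total order $\preceq$, extended co-lexicographically to $\Sigma^*$ ($\alpha\preceq\beta$ iff reverse of $\alpha$ is lexicographically $\le$ reverse of $\beta$; $\prec$ strict). An NFA is $\mathcal{A}=(Q,E,s,F)$ with finite $Q$, $E\subseteq Q\times Q\times\Sigma$; every state is reachable from $s$ and can reach a final state. $I_u$ is the set of strings readable from $s$ to $u$. Let $\#,@\notin\Sigma$ with $\#\prec @\prec a$ for all $a\in\Sigma$. $\lambda(v)$ is the set of labels of edges entering $v$ if any, else $\{\#\}$, and $@$ is added if $v=s$. $\lambda(u)\,\angle\,\lambda(v)$ iff $x\preceq y$ for all $x\in\lambda(u),y\in\lambda(v)$. A co-lex relation is a reflexive $R\subseteq Q\times Q$ with (Axiom 1) $u\neq v$, $(u,v)\in R$ implies $\lambda(u)\,\angle\,\lambda(v)$; (Axiom 2) for $(u',u,a),(v',v,a)\in E$ with $u\neq v$, $(u,v)\in R$, $(u',v')\in R$. On $\{I_u:u\in Q\}$, $\preceq$ is the reflexive relation with, for $I_u\neq I_v$: $I_u\prec I_v$ iff for all $\alpha\in I_u,\beta\in I_v$ with $\{\alpha,\beta\}\not\subseteq I_u\cap I_v$, $\alpha\prec\beta$. -}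

module Defs where

open import Data.Nat using (ℕ)
open import Data.Fin using (Fin) renaming (_<_ to _<ᶠ_; _≤_ to _≤ᶠ_)
open import Data.List using (List; []; _∷_; _∷ʳ_; reverse)
open import Data.List.Membership.Propositional using (_∈_)
open import Data.List.Relation.Binary.Lex.Core using (Lex-<)
open import Data.Product using (_×_; _,_; ∃; ∃-syntax)
open import Data.Sum using (_⊎_)
open import Relation.Nullary using (¬_)
open import Relation.Binary.PropositionalEquality using (_≡_)

-- Alphabet: Fin k with its natural (total) order (any finite totally
-- ordered alphabet is order-isomorphic to such a Fin k).
-- States: Fin n.

record NFA (n k : ℕ) : Set where
  field
    E : List (Fin n × Fin n × Fin k)   -- edges (source, target, label)
    s : Fin n
    F : List (Fin n)

module _ {n k : ℕ} (A : NFA n k) where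
  open NFA A

  data Reads : Fin n → List (Fin k) → Fin n → Set where
    nil  : ∀ {p} → Reads p [] p
    snoc : ∀ {p α q r a} → Reads p α q → (q , r , a) ∈ E → Reads p (α ∷ʳ a) r

  I : Fin n → List (Fin k) → Set
  I u α = Reads s α u

  WellFormed : Set
  WellFormed = (∀ u → ∃[ α ] I u α) × (∀ u → ∃[ f ] ∃[ β ] (f ∈ F × Reads u β f))

data Label (k : ℕ) : Set where
  hash : Label k
  at   : Label k
  sym  : Fin k → Label k

data _≤ᴸ_ {k : ℕ} : Label k → Label k → Set where
  hash≤ : ∀ {y} → hash ≤ᴸ y
  at≤at : at ≤ᴸ at
  at≤sym : ∀ {a} → at ≤ᴸ sym a
  sym≤sym : ∀ {a b} → a ≤ᶠ b → sym a ≤ᴸ sym b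

module _ {n k : ℕ} (A : NFA n k) where
  open NFA A

  data InLam (v : Fin n) : Label k → Set where
    inEdge : ∀ {u a} → (u , v , a) ∈ E → InLam v (sym a)
    noIn   : (∀ u a → ¬ ((u , v , a) ∈ E)) → InLam v hash
    initial : v ≡ s → InLam v at

  _∠_ : Fin n → Fin n → Set
  u ∠ v = ∀ x y → InLam u x → InLam v y → x ≤ᴸ y

  record IsCoLex (R : Fin n → Fin n → Set) : Set where
    field
      refl   : ∀ u → R u u
      axiom1 : ∀ u v → ¬ (u ≡ v) → R u v → u ∠ v
      axiom2 : ∀ u' u v' v a → (u' , u , a) ∈ E → (v' , v , a) ∈ E →
               ¬ (u ≡ v) → R u v → R u' v'

_≺_ : {k : ℕ} → List (Fin k) → List (Fin k) → Set
α ≺ β = Lex-< _≡_ _<ᶠ_ (reverse α) (reverse β)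

module _ {n k : ℕ} (A : NFA n k) where

  SameI : Fin n → Fin n → Set
  SameI u v = ∀ α → (I A u α → I A v α) × (I A v α → I A u α)

  StrictI : Fin n → Fin n → Set
  StrictI u v = ∀ α β → I A u α → I A v β →
                ¬ ((I A u α × I A v α) × (I A u β × I A v β)) → α ≺ β

  _⪯I_ : Fin n → Fin n → Set
  u ⪯I v = SameI u v ⊎ StrictI u v

{-# OPTIONS --safe #-}
module Submission where

-- Compare α ∈ I_u and β ∈ I_v from their last letters. Axiom 1 orders the
-- last letters of strings entering distinct states, and puts every letter
-- above the mark @ of the initial state, which is the only state reading ε.
-- When the last letters agree, Axiom 2 relates the predecessor states and we
-- recurse on the shorter strings; if a recursion reaches u = v, the two
-- strings read so far are common to both sets, which the hypothesis excludes.
-- The strict condition therefore always holds; when I_u = I_v it is vacuous.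

open import Defs
open import Data.Nat using (ℕ)
open import Data.Fin using (Fin; _≟_) renaming (_<_ to _<ᶠ_; _≤_ to _≤ᶠ_)
open import Data.Fin.Properties using (≤∧≢⇒<)
open import Data.List using (List; []; _∷_; _∷ʳ_; reverse; [_])
open import Data.List.Properties using (reverse-++)
open import Data.List.Relation.Binary.Lex.Core using (halt; this; next)
open import Data.Product using (_×_; _,_) renaming (map to map-×)
open import Data.Sum using (inj₂)
open import Data.Empty using (⊥-elim)
open import Data.List.Membership.Propositional using (_∈_)
open import Function using (_∘_)
open import Relation.Nullary using (¬_; yes; no)
open import Relation.Binary.PropositionalEquality using (_≡_; _≢_; refl)

reverse-∷ʳ : ∀ {a} {A : Set a} (xs : List A) x → reverse (xs ∷ʳ x) ≡ x ∷ reverse xs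
reverse-∷ʳ xs x = reverse-++ xs [ x ]

module _ {k : ℕ} where

  []≺∷ʳ : ∀ (β : List (Fin k)) b → [] ≺ (β ∷ʳ b)
  []≺∷ʳ β b rewrite reverse-∷ʳ β b = halt

  ∷ʳ-≺-∷ʳ : ∀ (α β : List (Fin k)) {a b} → a <ᶠ b → (α ∷ʳ a) ≺ (β ∷ʳ b)
  ∷ʳ-≺-∷ʳ α β {a} {b} a<b rewrite reverse-∷ʳ α a | reverse-∷ʳ β b = this a<b

  ∷ʳ-mono-≺ : ∀ (α β : List (Fin k)) a → α ≺ β → (α ∷ʳ a) ≺ (β ∷ʳ a)
  ∷ʳ-mono-≺ α β a α≺β rewrite reverse-∷ʳ α a | reverse-∷ʳ β a = next refl α≺β

  sym≰at : ∀ {a : Fin k} → ¬ (sym a ≤ᴸ at)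
  sym≰at ()

  sym≤sym⁻¹ : ∀ {a b : Fin k} → sym a ≤ᴸ sym b → a ≤ᶠ b
  sym≤sym⁻¹ (sym≤sym a≤b) = a≤b

module _ {n k : ℕ} (A : NFA n k) where
  open NFA A

  Common : Fin n → Fin n → List (Fin k) → Set
  Common u v α = I A u α × I A v α

  common-∷ʳ : ∀ {u' u v' v α a} → (u' , u , a) ∈ E → (v' , v , a) ∈ E →
              Common u' v' α → Common u v (α ∷ʳ a)
  common-∷ʳ e f (u'α , v'α) = snoc u'α e , snoc v'α f

  module _ {R : Fin n → Fin n → Set} (coLex : IsCoLex A R) where
    open IsCoLex coLex using (axiom1; axiom2)

    mutual
      coLex⇒StrictI : ∀ {u v} → R u v → StrictI A u v
      coLex⇒StrictI {u} {v} uRv α β uα vβ notCommon with u ≟ v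
      ... | yes refl = ⊥-elim (notCommon ((uα , uα) , (vβ , vβ)))
      ... | no u≢v   = ≺-of-distinct uRv u≢v uα vβ notCommon

      ≺-of-distinct : ∀ {u v α β} → R u v → u ≢ v → I A u α → I A v β →
                      ¬ (Common u v α × Common u v β) → α ≺ β
      ≺-of-distinct _ u≢v nil nil _ = ⊥-elim (u≢v refl)
      ≺-of-distinct _ _ nil (snoc {α = β} {a = b} _ _) _ = []≺∷ʳ β b
      ≺-of-distinct uRv u≢v (snoc _ e) nil _ =
        ⊥-elim (sym≰at (axiom1 _ _ u≢v uRv _ _ (inEdge e) (initial refl)))
      ≺-of-distinct uRv u≢v (snoc {α = α} {a = a} u'α e) (snoc {α = β} {a = b} v'β f) notCommon
        with a ≟ b
      ... | no a≢b =
        ∷ʳ-≺-∷ʳ α β (≤∧≢⇒< (sym≤sym⁻¹ (axiom1 _ _ u≢v uRv _ _ (inEdge e) (inEdge f))) a≢b)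
      ... | yes refl =
        ∷ʳ-mono-≺ α β a (coLex⇒StrictI (axiom2 _ _ _ _ a e f u≢v uRv) α β u'α v'β
          (notCommon ∘ map-× (common-∷ʳ e f) (common-∷ʳ e f)))

lemma16 : {n k : ℕ} (A : NFA n k) → WellFormed A →
          (R : Fin n → Fin n → Set) → IsCoLex A R →
          ∀ u v → R u v → _⪯I_ A u v
lemma16 A _ R coLex u v uRv = inj₂ (coLex⇒StrictI A coLex uRv)
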